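{- An indecomposable query clause is an isolated-only query clause if and only if it is a guarded clause.
   Context: Clauses are finite multisets of literals without equality; $\mathrm{Var}(E)$ is the set of variables of $E$. A literal is flat if each argument is a variable or constant. A query clause is a flat clause all of whose literals are negative. A clause is indecomposable if it cannot be partitioned into two nonempty variable-disjoint subclauses. A guarded clause is an equality-free clause $C$ in which every argument of every literal is a variable, a constant, or $f(u_1,\dots,u_n)$ with each $u_i$ a variable or constant, every compound term (term neither variable nor constant) $t$ satisfies $\mathrm{Var}(t)=\mathrm{Var}(C)$, and which is either ground or contains a negative flat literal $\neg G$ with $\mathrm{Var}(G)=\mathrm{Var}(C)$. A literal $L$ of a query clause $Q$ is a surface literal if there is no literal $L'$ of $Q$ distinct from $L$ with $\mathrm{Var}(L)\subsetneq\mathrm{Var}(L')$. If $L_1,\dots,L_n$ ($n>1$) are the surface literals of $Q$, the chained variables of $Q$ are the variables in $\mathrm{Var}(L_i)\cap\mathrm{Var}(L_j)$ for pairs $i,j$ with $\mathrm{Var}(L_i)\neq\mathrm{Var}(L_j)$; all other variables of $Q$ are isolated. $Q$ is an isolated-only query clause if all of its variables are isolated. -}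

module Defs where

open import Data.Nat using (ℕ)
open import Data.Bool using (Bool; true; false)
open import Data.Empty using (⊥)
open import Data.Unit using (⊤)
open import Data.Product using (Σ; ∃; _×_; _,_)
open import Data.Sum using (_⊎_)
open import Data.Vec using (Vec)
import Data.Vec.Relation.Unary.Any as VAny
import Data.Vec.Relation.Unary.All as VAll
open import Data.List using (List; [])
import Data.List.Relation.Unary.Any as LAny
open import Data.List.Membership.Propositional using (_∈_)
open import Data.List.Relation.Binary.Permutation.Propositional using (_↭_)
open import Data.List using (_++_)
open import Relation.Binary.PropositionalEquality using (_≡_; _≢_)
open import Relation.Nullary using (¬_)

-- A first-order signature (no equality symbol). Constants are the
-- function symbols of arity 0.
record Signature : Set₁ where
  field
    PredSym  : Set
    predArity : PredSym → ℕ
    FunSym   : Set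
    funArity : FunSym → ℕ

module _ (S : Signature) where
  open Signature S

  data Term : Set where
    var : ℕ → Term
    fun : (f : FunSym) → Vec Term (funArity f) → Term

  data _occursIn_ (x : ℕ) : Term → Set where
    here : x occursIn var x
    inArg : ∀ {f ts} → VAny.Any (x occursIn_) ts → x occursIn fun f ts

  IsVar : Term → Set
  IsVar (var _) = ⊤
  IsVar (fun _ _) = ⊥

  IsConst : Term → Set
  IsConst (var _) = ⊥
  IsConst (fun f _) = funArity f ≡ 0

  FlatTerm : Term → Set
  FlatTerm t = IsVar t ⊎ IsConst t

  Compound : Term → Set
  Compound t = ¬ FlatTerm t

  record Atom : Set where
    constructor atom
    field
      pred : PredSym
      args : Vec Term (predArity pred)

  record Literal : Set where
    constructor lit
    field
      positive : Bool
      theAtom  : Atom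
    open Atom theAtom public

  -- clauses: finite multisets of literals, represented as lists
  Clause : Set
  Clause = List Literal

  VarL : Literal → ℕ → Set
  VarL L x = VAny.Any (x occursIn_) (Literal.args L)

  VarC : Clause → ℕ → Set
  VarC C x = LAny.Any (λ L → VarL L x) C

  _⊆ᵥ_ : (ℕ → Set) → (ℕ → Set) → Set
  A ⊆ᵥ B = ∀ x → A x → B x

  _≐ᵥ_ : (ℕ → Set) → (ℕ → Set) → Set
  A ≐ᵥ B = A ⊆ᵥ B × B ⊆ᵥ A

  _⊂ᵥ_ : (ℕ → Set) → (ℕ → Set) → Set
  A ⊂ᵥ B = A ⊆ᵥ B × ¬ (B ⊆ᵥ A)

  Negative : Literal → Set
  Negative L = Literal.positive L ≡ false

  FlatLiteral : Literal → Set
  FlatLiteral L = VAll.All FlatTerm (Literal.args L)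

  QueryClause : Clause → Set
  QueryClause C = ∀ L → L ∈ C → Negative L × FlatLiteral L

  Indecomposable : Clause → Set
  Indecomposable C =
    ¬ (Σ Clause λ C₁ → Σ Clause λ C₂ →
        (C ↭ C₁ ++ C₂) × C₁ ≢ [] × C₂ ≢ [] ×
        (∀ x → VarC C₁ x → ¬ VarC C₂ x))

  Surface : Clause → Literal → Set
  Surface Q L = L ∈ Q ×
    ¬ (Σ Literal λ L' → L' ∈ Q × L' ≢ L × (VarL L ⊂ᵥ VarL L'))

  Chained : Clause → ℕ → Set
  Chained Q x = Σ Literal λ L₁ → Σ Literal λ L₂ →
    Surface Q L₁ × Surface Q L₂ × ¬ (VarL L₁ ≐ᵥ VarL L₂) ×
    VarL L₁ x × VarL L₂ x

  Isolated : Clause → ℕ → Set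
  Isolated Q x = VarC Q x × ¬ Chained Q x

  IsolatedOnlyQuery : Clause → Set
  IsolatedOnlyQuery Q = QueryClause Q × (∀ x → VarC Q x → Isolated Q x)

  GuardArg : Term → Set
  GuardArg (var _) = ⊤
  GuardArg (fun f us) = VAll.All FlatTerm us

  Ground : Clause → Set
  Ground C = ∀ x → ¬ VarC C x

  -- guarded clause (equality-freeness is built into the language: no equality symbol)
  Guarded : Clause → Set
  Guarded C =
    (∀ L → L ∈ C → VAll.All GuardArg (Literal.args L)) ×
    (∀ L → L ∈ C → ∀ t → VAny.Any (t ≡_) (Literal.args L) → Compound t →
       ((λ x → x occursIn t) ≐ᵥ VarC C)) ×
    (Ground C ⊎ (Σ Literal λ G → G ∈ C × Negative G × FlatLiteral G ×
                   (VarL G ≐ᵥ VarC C)))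

module Submission where

-- Write L ≼ M when Var(L) ⊆ Var(M).  The surface literals of Q are exactly the
-- ≼-maximal literals of Q, and since ≼ is a decidable preorder on a finite list,
-- every literal of Q lies below some surface literal (maximal-above).
--
-- (⇒) Flat arguments are admissible guard arguments and a flat literal has no
-- compound arguments, so only the guard condition needs work.  Pick a surface
-- literal G.  If L ≼ G and M ⋠ G, then L and M share no variable: a shared x
-- would lie in G and in a surface literal above M, whose variable set differs
-- from Var(G), so x would be chained.  Indecomposability therefore forces every
-- literal below G (indecomposable-closed), i.e. Var(G) = Var(Q), and G is the
-- guard; an empty clause is ground.
--
-- (⇐) If G ∈ Q is a flat negative literal with Var(G) = Var(Q), then every
-- surface literal has exactly the variables of G, so no two surface literals
-- have different variable sets and no variable is chained.  A ground clause
-- has no variables at all.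

open import Defs
open import Function.Bundles using (Equivalence; _⇔_; mk⇔)
open import Data.Nat using (ℕ)
open import Data.Nat.Properties using (_≟_)
open import Data.Empty using (⊥-elim)
open import Data.Unit using (tt)
open import Data.Product using (Σ; _×_; _,_; proj₁; proj₂)
open import Data.Sum using (_⊎_; inj₁; inj₂)
open import Data.Vec using (Vec; []; _∷_)
import Data.Vec.Relation.Unary.Any as VAny
import Data.Vec.Relation.Unary.All as VAll
open import Data.List using (List; []; _∷_; _++_; filter)
import Data.List.Relation.Unary.Any as LAny
import Data.List.Relation.Unary.All as LAll
open import Data.List.Properties using (partition-defn)
open import Data.List.Membership.Propositional using (_∈_; find; lose)
open import Data.List.Membership.Propositional.Properties
  using (∈-++⁺ˡ; ∈-++⁺ʳ; ∈-++⁻; ∈-filter⁺; ∈-filter⁻)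
open import Data.List.Membership.DecPropositional _≟_ using (_∈?_)
open import Data.List.Relation.Binary.Permutation.Propositional using (_↭_; ↭ₛ⇒↭)
import Data.List.Relation.Binary.Permutation.Setoid.Properties as SetoidPerm
open import Relation.Binary.Core using (Rel)
open import Relation.Binary.Definitions using (Reflexive; Transitive) renaming (Decidable to Decidable₂)
open import Relation.Binary.PropositionalEquality using (_≡_; _≢_; refl; subst; setoid)
open import Relation.Nullary using (¬_; Dec; yes; no; ¬?)
open import Relation.Nullary.Decidable using (_×-dec_)
open import Relation.Unary using (Pred; Decidable)
open import Relation.Unary.Properties using (∁?)

module MaximalElements {a ℓ} {A : Set a} (_≤_ : Rel A ℓ)
    (≤-refl : Reflexive _≤_) (≤-trans : Transitive _≤_) (_≤?_ : Decidable₂ _≤_) where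

  _<_ : Rel A ℓ
  x < y = x ≤ y × ¬ (y ≤ x)

  _<?_ : Decidable₂ _<_
  x <? y = (x ≤? y) ×-dec ¬? (y ≤? x)

  Maximal : List A → A → Set _
  Maximal xs m = ∀ y → y ∈ xs → ¬ (m < y)

  -- Induction on the tail: take a maximal m for x ∷ ys; if the new head y is
  -- strictly above m, a maximal element above y (for y ∷ ys) is also above x.
  maximal-above : ∀ x xs → Σ A λ m → m ∈ x ∷ xs × x ≤ m × Maximal (x ∷ xs) m
  maximal-above x [] = x , LAny.here refl , ≤-refl , maximal
    where
    maximal : Maximal (x ∷ []) x
    maximal _ (LAny.here refl) (_ , x≰x) = x≰x ≤-refl
  maximal-above x (y ∷ ys) with maximal-above x ys
  ... | m , m∈ , x≤m , m-max with m <? y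
  ...   | no m≮y = m , widen m∈ , x≤m , maximal
    where
    widen : m ∈ x ∷ ys → m ∈ x ∷ y ∷ ys
    widen (LAny.here eq) = LAny.here eq
    widen (LAny.there m∈ys) = LAny.there (LAny.there m∈ys)
    maximal : Maximal (x ∷ y ∷ ys) m
    maximal z (LAny.here refl) = m-max z (LAny.here refl)
    maximal z (LAny.there (LAny.here refl)) = m≮y
    maximal z (LAny.there (LAny.there z∈ys)) = m-max z (LAny.there z∈ys)
  ...   | yes (m≤y , _) with maximal-above y ys
  ...     | m′ , m′∈ , y≤m′ , m′-max = m′ , LAny.there m′∈ , x≤m′ , maximal
    where
    x≤m′ : x ≤ m′
    x≤m′ = ≤-trans x≤m (≤-trans m≤y y≤m′)
    maximal : Maximal (x ∷ y ∷ ys) m′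
    maximal z (LAny.here refl) (_ , x≰m′) = x≰m′ x≤m′
    maximal z (LAny.there z∈) = m′-max z z∈

filter-split-↭ : ∀ {a p} {A : Set a} {P : Pred A p} (P? : Decidable P) (xs : List A) →
  xs ↭ filter P? xs ++ filter (∁? P?) xs
filter-split-↭ P? xs =
  subst (λ parts → xs ↭ proj₁ parts ++ proj₂ parts) (partition-defn P? xs)
        (↭ₛ⇒↭ (SetoidPerm.partition-↭ (setoid _) P? xs))

Enumerates : List ℕ → (ℕ → Set) → Set
Enumerates xs P = ∀ x → P x ⇔ x ∈ xs

inclusion? : ∀ {P R xs ys} → Enumerates xs P → Enumerates ys R → Dec (∀ x → P x → R x)
inclusion? {xs = xs} {ys} P⇔xs R⇔ys with LAll.all? (_∈? ys) xs
... | yes xs⊆ys = yes λ x Px → R⇔ys x .from (LAll.lookup xs⊆ys (P⇔xs x .to Px))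
  where open Equivalence
... | no xs⊈ys = no λ P⊆R → xs⊈ys (LAll.tabulate λ {x} x∈xs →
                   R⇔ys x .to (P⊆R x (P⇔xs x .from x∈xs)))
  where open Equivalence

module _ (S : Signature) where

  mutual
    varsT : Term S → List ℕ
    varsT (var x) = x ∷ []
    varsT (fun f ts) = varsTs ts

    varsTs : ∀ {n} → Vec (Term S) n → List ℕ
    varsTs [] = []
    varsTs (t ∷ ts) = varsT t ++ varsTs ts

  mutual
    occurs⇒∈ : ∀ {x t} → _occursIn_ S x t → x ∈ varsT t
    occurs⇒∈ here = LAny.here refl
    occurs⇒∈ (inArg x∈ts) = occursAny⇒∈ x∈ts

    occursAny⇒∈ : ∀ {x n} {ts : Vec (Term S) n} → VAny.Any (_occursIn_ S x) ts → x ∈ varsTs ts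
    occursAny⇒∈ {ts = t ∷ ts} (VAny.here x∈t) = ∈-++⁺ˡ (occurs⇒∈ x∈t)
    occursAny⇒∈ {ts = t ∷ ts} (VAny.there x∈ts) = ∈-++⁺ʳ (varsT t) (occursAny⇒∈ x∈ts)

  mutual
    ∈⇒occurs : ∀ {x} t → x ∈ varsT t → _occursIn_ S x t
    ∈⇒occurs (var y) (LAny.here refl) = here
    ∈⇒occurs (fun f ts) x∈ = inArg (∈⇒occursAny ts x∈)

    ∈⇒occursAny : ∀ {x n} (ts : Vec (Term S) n) → x ∈ varsTs ts → VAny.Any (_occursIn_ S x) ts
    ∈⇒occursAny (t ∷ ts) x∈ with ∈-++⁻ (varsT t) x∈
    ... | inj₁ x∈t = VAny.here (∈⇒occurs t x∈t)
    ... | inj₂ x∈ts = VAny.there (∈⇒occursAny ts x∈ts)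

  varsL-enumerates : ∀ L → Enumerates (varsTs (Literal.args L)) (VarL S L)
  varsL-enumerates L x = mk⇔ occursAny⇒∈ (∈⇒occursAny (Literal.args L))

  _≼_ : Rel (Literal S) _
  L ≼ M = _⊆ᵥ_ S (VarL S L) (VarL S M)

  _≼?_ : Decidable₂ _≼_
  L ≼? M = inclusion? (varsL-enumerates L) (varsL-enumerates M)

  open MaximalElements _≼_ (λ x v → v) (λ L≼M M≼N x v → M≼N x (L≼M x v)) _≼?_

  surface-above : ∀ {Q L} → L ∈ Q → Σ (Literal S) λ G → Surface S Q G × L ≼ G
  surface-above {Q} {L} L∈Q with maximal-above L Q
  ... | G , G∈ , L≼G , G-max = G , (G∈Q G∈ , not-below) , L≼G
    where
    G∈Q : G ∈ L ∷ Q → G ∈ Q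
    G∈Q (LAny.here refl) = L∈Q
    G∈Q (LAny.there G∈Q) = G∈Q
    not-below : ¬ (Σ (Literal S) λ L′ → L′ ∈ Q × L′ ≢ G × _⊂ᵥ_ S (VarL S G) (VarL S L′))
    not-below (L′ , L′∈Q , _ , G<L′) = G-max L′ (LAny.there L′∈Q) G<L′

  indecomposable-closed : ∀ {p} {C : Clause S} {P : Pred (Literal S) p} → Indecomposable S C →
    (P? : Decidable P) → (Σ (Literal S) λ L → L ∈ C × P L) →
    (∀ {A B} x → A ∈ C → B ∈ C → P A → ¬ P B → VarL S A x → ¬ VarL S B x) →
    ∀ L → L ∈ C → P L
  indecomposable-closed {C = C} indec P? (A , A∈C , PA) separated L L∈C with P? L
  ... | yes PL = PL
  ... | no ¬PL = ⊥-elim (indec (filter P? C , filter (∁? P?) C , filter-split-↭ P? C ,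
                                nonempty (∈-filter⁺ P? A∈C PA) ,
                                nonempty (∈-filter⁺ (∁? P?) L∈C ¬PL) ,
                                disjoint))
    where
    nonempty : ∀ {K : Literal S} {Ks} → K ∈ Ks → ¬ (Ks ≡ [])
    nonempty K∈Ks refl with K∈Ks
    ... | ()
    disjoint : ∀ x → VarC S (filter P? C) x → ¬ VarC S (filter (∁? P?) C) x
    disjoint x x∈C₁ x∈C₂ with find x∈C₁ | find x∈C₂
    ... | A′ , A′∈ , x∈A′ | B′ , B′∈ , x∈B′ with ∈-filter⁻ P? A′∈ | ∈-filter⁻ (∁? P?) B′∈
    ...   | A′∈C , PA′ | B′∈C , ¬PB′ = separated x A′∈C B′∈C PA′ ¬PB′ x∈A′ x∈B′

  NoChained : Clause S → Set
  NoChained Q = ∀ x → VarC S Q x → ¬ Chained S Q x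

  below-surface-separated : ∀ {Q G} → NoChained Q → Surface S Q G →
    ∀ {A B} x → A ∈ Q → B ∈ Q → A ≼ G → ¬ B ≼ G → VarL S A x → ¬ VarL S B x
  below-surface-separated {G = G} unchained G-surf x A∈Q B∈Q A≼G B⋠G x∈A x∈B
    with surface-above B∈Q
  ... | M , M-surf , B≼M =
    unchained x (lose A∈Q x∈A)
      (G , M , G-surf , M-surf , different , A≼G x x∈A , B≼M x x∈B)
    where
    different : ¬ _≐ᵥ_ S (VarL S G) (VarL S M)
    different (_ , M≼G) = B⋠G λ y y∈B → M≼G y (B≼M y y∈B)

  HasGuard : Clause S → Set
  HasGuard C = Ground S C ⊎ (Σ (Literal S) λ G → G ∈ C × Negative S G × FlatLiteral S G ×
                              _≐ᵥ_ S (VarL S G) (VarC S C))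

  guard-of-unchained : ∀ {Q} → QueryClause S Q → Indecomposable S Q → NoChained Q → HasGuard Q
  guard-of-unchained {[]} _ _ _ = inj₁ λ x ()
  guard-of-unchained {Q@(_ ∷ _)} query indec unchained with surface-above {Q} (LAny.here refl)
  ... | G , G-surf@(G∈Q , _) , _ =
    inj₂ (G , G∈Q , proj₁ (query G G∈Q) , proj₂ (query G G∈Q) , (λ x x∈G → lose G∈Q x∈G) , Q⊆G)
    where
    all-below : ∀ L → L ∈ Q → L ≼ G
    all-below = indecomposable-closed indec (_≼? G) (G , G∈Q , λ x x∈G → x∈G)
                                      (below-surface-separated unchained G-surf)
    Q⊆G : ∀ x → VarC S Q x → VarL S G x
    Q⊆G x x∈Q with find x∈Q
    ... | L′ , L′∈Q , x∈L′ = all-below L′ L′∈Q x x∈L′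

  -- If G ∈ Q contains all variables of Q, every literal of Q is below G, and
  -- every surface literal is above G (otherwise it would lie strictly below G).
  module _ {Q G} (G∈Q : G ∈ Q) (Q⊆G : ∀ x → VarC S Q x → VarL S G x) where

    below-guard : ∀ {L} → L ∈ Q → L ≼ G
    below-guard L∈Q x x∈L = Q⊆G x (lose L∈Q x∈L)

    guard-below-surface : ∀ {L} → Surface S Q L → G ≼ L
    guard-below-surface {L} (L∈Q , L-max) with G ≼? L
    ... | yes G≼L = G≼L
    ... | no G⋠L = ⊥-elim (L-max (G , G∈Q , G≢L , below-guard L∈Q , G⋠L))
      where
      G≢L : G ≢ L
      G≢L refl = G⋠L λ x x∈G → x∈G

  unchained-of-guard : ∀ {Q} → HasGuard Q → NoChained Q
  unchained-of-guard (inj₁ ground) x x∈Q _ = ground x x∈Q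
  unchained-of-guard {Q} (inj₂ (G , G∈Q , _ , _ , _ , Q⊆G)) x _
                     (L₁ , L₂ , L₁-surf , L₂-surf , different , _) =
    different (surface≼surface L₁-surf L₂-surf , surface≼surface L₂-surf L₁-surf)
    where
    surface≼surface : ∀ {L M} → Surface S Q L → Surface S Q M → L ≼ M
    surface≼surface (L∈Q , _) M-surf y y∈L =
      guard-below-surface G∈Q Q⊆G M-surf y (below-guard G∈Q Q⊆G L∈Q y y∈L)

  flat⇒guardArg : ∀ {t} → FlatTerm S t → GuardArg S t
  flat⇒guardArg {var _} _ = tt
  flat⇒guardArg {fun f us} (inj₂ arity≡0) = no-arguments us arity≡0
    where
    no-arguments : ∀ {n} (vs : Vec (Term S) n) → n ≡ 0 → VAll.All (FlatTerm S) vs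
    no-arguments [] _ = VAll.[]

mainTheorem15 : (S : Signature) (Q : Clause S) →
    QueryClause S Q → Indecomposable S Q →
    (IsolatedOnlyQuery S Q ⇔ Guarded S Q)
mainTheorem15 S Q query indec = mk⇔ forward backward
  where
  forward : IsolatedOnlyQuery S Q → Guarded S Q
  forward (_ , isolated) =
    (λ L L∈Q → VAll.map (flat⇒guardArg S) (proj₂ (query L L∈Q))) ,
    (λ L L∈Q t t∈L compound → ⊥-elim (compound (VAll.lookup (proj₂ (query L L∈Q)) t∈L))) ,
    guard-of-unchained S query indec (λ x x∈Q → proj₂ (isolated x x∈Q))

  backward : Guarded S Q → IsolatedOnlyQuery S Q
  backward (_ , _ , guard) = query , λ x x∈Q → x∈Q , unchained-of-guard S guard x x∈Q
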